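{- On every valid cover array $C[1\dots n]$ (the minimal-cover or maximal-cover array of some string of length $n$), Algorithm SIMA (described in the context), with the graph stored by adjacency lists, its connected components computed by depth-first search, and the border lengths $B[i]$ of the constructed prefixes computed online by the standard failure-function (KMP) method, runs in $O(n)$ time.
   Context: Strings are indexed from 1; $x[i\dots j]$ denotes a factor. A border of a string $u$ is a string that is both a proper prefix and a suffix of $u$ (possibly empty). A string $w$ of length $m$ is a cover of $y[1\dots k]$ if $m<k$ and there is a set $P\subseteq\{1,\dots,k-m+1\}$ with $y[p\dots p+m-1]=w$ for all $p\in P$ and $\bigcup_{p\in P}\{p,\dots,p+m-1\}=\{1,\dots,k\}$. The minimal-cover array $C$ of $y[1\dots n]$ has $C[i]$ equal to the length of the shortest cover of $y[1\dots i]$ if one exists, and $0$ otherwise; the maximal-cover array stores the length of the longest cover instead. Algorithm SIMA, on input an integer array $C[1\dots n]$: Step 1 (MaxToMin): for $i=1,\dots,n$ in increasing order, if $C[i]\ne 0$ and $C[C[i]]\ne 0$, replace $C[i]$ by $C[C[i]]$. Step 2 (Prune): set $l:=0$; for $i=n,n-1,\dots,1$: if $l\ge C[i]$ set $C[i]:=0$; then set $l:=\max(0,\max(l,C[i])-1)$. Call the resulting array $C^P$. Step 3 (Inference): build the undirected graph $G$ on vertex set $\{1,\dots,n\}$ with an edge $\{j,\ i-C^P[i]+j\}$ for every $i\in\{1,\dots,n\}$ and every $1\le j\le C^P[i]$. Process positions $i=1,\dots,n$ in increasing order; whenever $x[i]$ is not yet assigned (so $i$ is the smallest element of its connected component in $G$),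 choose a letter $c$ as follows: if $i=1$, $c=a$; otherwise let $B[i-1]$ be the length of the longest border of the already constructed prefix $x[1\dots i-1]$, and set $c=b$ if $x[B[i-1]+1]=a$ and $c=a$ otherwise. Assign $c$ to $x[p]$ for every vertex $p$ in the connected component of $i$. Output $x[1\dots n]$. -}

module Defs where

open import Data.Nat using (ℕ; zero; suc; _+_; _*_; _∸_; _≤_; _<_; _⊔_; _⊓_)
open import Data.Nat.Properties using (_≟_; _≤?_)
open import Data.Bool using (Bool; true; false; if_then_else_)
open import Data.List using (List; []; _∷_; length; lookup; foldl; _++_)
open import Data.Fin using (Fin; toℕ)
open import Data.Product using (Σ; ∃; _×_; _,_; proj₁; proj₂)
open import Data.Sum using (_⊎_)
open import Relation.Nullary using (¬_; does)
open import Relation.Binary.PropositionalEquality using (_≡_)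

-- Strings and arrays are 1-indexed functions ℕ → ℕ; only the indices
-- 1..n are meaningful.  Letters are natural numbers (every finite string
-- over any alphabet can be relabelled into ℕ without changing its covers).

Str : Set
Str = ℕ → ℕ

Arr : Set
Arr = ℕ → ℕ

record IsCover (y : Str) (k : ℕ) (w : List ℕ) : Set where
  field
    short    : length w < k
    P        : ℕ → Bool
    P-range  : ∀ p → P p ≡ true → (1 ≤ p) × (p + length w ≤ k + 1)
    P-occ    : ∀ p → P p ≡ true → (j : Fin (length w)) →
               y (p + toℕ j) ≡ lookup w j
    P-covers : ∀ q → 1 ≤ q → q ≤ k →
               ∃ λ p → (P p ≡ true) × (p ≤ q) × (q < p + length w)

HasCover : Str → ℕ → ℕ → Set
HasCover y k m = ∃ λ (w : List ℕ) → (length w ≡ m) × IsCover y k w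

IsMinCoverArray : ℕ → Str → Arr → Set
IsMinCoverArray n y C = ∀ i → 1 ≤ i → i ≤ n →
    ((C i ≡ 0) × (∀ m → ¬ HasCover y i m))
  ⊎ (HasCover y i (C i) × (∀ m → HasCover y i m → C i ≤ m))

IsMaxCoverArray : ℕ → Str → Arr → Set
IsMaxCoverArray n y C = ∀ i → 1 ≤ i → i ≤ n →
    ((C i ≡ 0) × (∀ m → ¬ HasCover y i m))
  ⊎ (HasCover y i (C i) × (∀ m → HasCover y i m → m ≤ C i))

ValidCoverArray : ℕ → Arr → Set
ValidCoverArray n C =
  ∃ λ (y : Str) → IsMinCoverArray n y C ⊎ IsMaxCoverArray n y C

eqb : ℕ → ℕ → Bool
eqb m n = does (m ≟ n)

leb : ℕ → ℕ → Bool
leb m n = does (m ≤? n)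

update : Arr → ℕ → ℕ → Arr
update f k v j = if eqb j k then v else f j

maxToMin : ℕ → Arr → Arr
maxToMin zero    C = C
maxToMin (suc i) C =
  let C' = maxToMin i C
      c  = C' (suc i)
  in if (eqb c 0) then C'
     else (if eqb (C' c) 0 then C' else update C' (suc i) (C' c))

pruneLoop : ℕ → ℕ → Arr → Arr
pruneLoop zero    l C = C
pruneLoop (suc i) l C =
  let c  = C (suc i)
      c' = if leb c l then 0 else c
      l' = (l ⊔ c') ∸ 1
  in pruneLoop i l' (update C (suc i) c')

prune : ℕ → Arr → Arr
prune n C = pruneLoop n 0 C

pruned : ℕ → Arr → Arr
pruned n C = prune n (maxToMin n C)

edgesAt : (i c : ℕ) → ℕ → List (ℕ × ℕ)
edgesAt i c zero    = []
edgesAt i c (suc j) = edgesAt i c j ++ ((suc j , (i ∸ c) + suc j) ∷ [])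

edges : ℕ → Arr → List (ℕ × ℕ)
edges zero    CP = []
edges (suc i) CP = edges i CP ++ edgesAt (suc i) (CP (suc i)) (CP (suc i))

numEdges : ℕ → Arr → ℕ
numEdges n CP = length (edges n CP)

-- Connected components: label each vertex with the smallest vertex of its
-- component (n rounds of min-label propagation along all edges; a
-- component of an n-vertex graph has diameter < n).  This only *specifies*
-- the components; the cost of finding them is charged separately (DFS).
relaxEdge : Arr → ℕ × ℕ → Arr
relaxEdge lab (u , v) =
  let m = lab u ⊓ lab v in update (update lab u m) v m

relaxRounds : ℕ → List (ℕ × ℕ) → Arr → Arr
relaxRounds zero    es lab = lab
relaxRounds (suc r) es lab = relaxRounds r es (foldl relaxEdge lab es)

compMin : ℕ → Arr → Arr
compMin n CP = relaxRounds n (edges n CP) (λ p → p)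

letA letB : ℕ
letA = 0
letB = 1

-- KMP failure-function loop for computing B[i] from B[1..i-1]:
--   b := B[i-1]; while b > 0 and x[b+1] ≠ x[i] do b := B[b].
-- Returns the final b together with the number of loop iterations.
-- (The fuel i is never exhausted, since b strictly decreases from b < i.)
kmpLoop : (fuel : ℕ) → Str → Arr → (i b : ℕ) → ℕ × ℕ
kmpLoop zero       x B i b = b , 0
kmpLoop (suc fuel) x B i zero = zero , 0
kmpLoop (suc fuel) x B i (suc b) =
  if eqb (x (suc (suc b))) (x i) then (suc b , 0)
  else (let r = kmpLoop fuel x B i (B (suc b)) in proj₁ r , suc (proj₂ r))

record InfState : Set where
  constructor st
  field
    xs   : Str
    bs   : Arr
    kmpC : ℕ

open InfState public

infStep : Arr → InfState → ℕ → InfState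
infStep lab (st x B k) i =
  let c  = if eqb i 1 then letA
           else (if eqb (x (suc (B (i ∸ 1)))) letA then letB else letA)
      x' = if eqb (lab i) i then (λ p → if eqb (lab p) i then c else x p) else x
  in if eqb i 1 then st x' (update B 1 0) k
     else (let r  = kmpLoop i x' B i (B (i ∸ 1))
               b  = proj₁ r
               b' = if eqb (x' (suc b)) (x' i) then suc b else 0
           in st x' (update B i b') (k + proj₂ r))

infLoop : Arr → ℕ → InfState
infLoop lab zero    = st (λ _ → 0) (λ _ → 0) 0
infLoop lab (suc i) = infStep lab (infLoop lab i) (suc i)

sima : ℕ → Arr → Str
sima n C = xs (infLoop (compMin n (pruned n C)) n)

-- Running time of SIMA in the unit-cost RAM model:
--   Step 1 (MaxToMin):                        n
--   Step 2 (Prune):                           n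
--   building adjacency lists of G:            n + 2·|E|   (n empty lists,
--                                             each edge inserted in both lists)
--   DFS over all components:                  n + 2·|E|   (each vertex visited,
--                                             each adjacency entry scanned once)
--   Inference loop:                           n (one O(1) step per position)
--                                             + total number of iterations of the
--                                               KMP failure-function loop.
simaCost : ℕ → Arr → ℕ
simaCost n C =
  let CP = pruned n C
      E  = numEdges n CP
  in n + n + (n + 2 * E) + (n + 2 * E) + (n + kmpC (infLoop (compMin n CP) n))

-- The cost is 5n + 4|E| plus the number of iterations of the failure-function loop, so it
-- suffices that |E| = Σ C^P[i] ≤ 2n and that the loop iterates at most n times in all. The
-- latter is the usual amortisation: iterations so far plus B[i] never exceed i, as every
-- iteration lowers the current border. For the former, a nonzero cover-array entry c at i is
-- a border of y[1..i], and a prefix without a cover has no border of at least half its length.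
-- MaxToMin composes borders, so afterwards every nonzero entry c at i is a border of y[1..i]
-- that is lean: it has no border of length ≥ c/2. In Prune the running value l is a border of
-- y[1..i]; an entry c > l that survives then has l as a border, so 2l < c by leanness, and the
-- potential 2(i - l) pays for c.
module Submission where

open import Defs
open import Data.Nat using (ℕ; zero; suc; _+_; _*_; _∸_; _≤_; _<_; _⊔_; z≤n; s≤s)
open import Data.Nat.Properties
open import Data.Nat.Tactic.RingSolver using (solve-∀)
open import Data.Bool using (Bool; true; false; if_then_else_; _∨_)
open import Data.Bool.Properties using (∨-zeroʳ)
open import Data.List using (List; length; lookup; applyUpTo)
open import Data.List.Properties using (length-++; length-applyUpTo; lookup-applyUpTo)
open import Data.Fin using (Fin; toℕ; fromℕ<)
open import Data.Fin.Properties using (toℕ-fromℕ<; toℕ<n)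
open import Data.Product using (∃; _×_; _,_; proj₁; proj₂)
open import Data.Sum using (_⊎_; inj₁; inj₂)
open import Relation.Nullary using (¬_; yes; no; proof; contradiction)
open import Relation.Nullary.Decidable using (dec-true; dec-false)
open import Relation.Nullary.Reflects using (Reflects; ofʸ; ofⁿ)
open import Relation.Binary.PropositionalEquality

update-≡ : ∀ f k v → update f k v k ≡ v
update-≡ f k v = cong (if_then v else f k) (dec-true (k ≟ k) refl)

update-≢ : ∀ f k v j → j ≢ k → update f k v j ≡ f j
update-≢ f k v j j≢k = cong (if_then v else f j) (dec-false (j ≟ k) j≢k)

[m∸n]+[n∸o]≡m∸o : ∀ {m n o} → o ≤ n → n ≤ m → (m ∸ n) + (n ∸ o) ≡ m ∸ o
[m∸n]+[n∸o]≡m∸o {m} {n} {o} o≤n n≤m = begin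
  (m ∸ n) + (n ∸ o) ≡⟨ +-∸-assoc (m ∸ n) o≤n ⟨
  (m ∸ n) + n ∸ o   ≡⟨ cong (_∸ o) (m∸n+n≡m n≤m) ⟩
  m ∸ o             ∎
  where open ≡-Reasoning

[m∸n]+o<m : ∀ {m n o} → n ≤ m → o < n → (m ∸ n) + o < m
[m∸n]+o<m {m} {n} {o} n≤m o<n = begin-strict
  (m ∸ n) + o <⟨ +-monoʳ-< (m ∸ n) o<n ⟩
  (m ∸ n) + n ≡⟨ m∸n+n≡m n≤m ⟩
  m           ∎
  where open ≤-Reasoning

module _ (y : Str) where

  -- The length-c prefix of y is a suffix of y[1..p].
  Border : ℕ → ℕ → Set
  Border p c = ∀ t → t < c → y (suc (p ∸ c) + t) ≡ y (suc t)

  NoLongBorder : ℕ → Set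
  NoLongBorder c = ∀ o → o < c → c ≤ o + o → ¬ Border c o

  record LeanBorder (p c : ℕ) : Set where
    field
      proper : c < p
      border : Border p c
      lean   : NoLongBorder c

  border-trans : ∀ {p c d} → Border p c → Border c d → d ≤ c → c ≤ p → Border p d
  border-trans {p} {c} {d} bpc bcd d≤c c≤p t t<d = begin
    y (suc (p ∸ d) + t)             ≡⟨ cong (λ s → y (suc (s + t))) ([m∸n]+[n∸o]≡m∸o d≤c c≤p) ⟨
    y (suc ((p ∸ c) + (c ∸ d)) + t) ≡⟨ cong (λ s → y (suc s)) (+-assoc (p ∸ c) (c ∸ d) t) ⟩
    y (suc (p ∸ c) + ((c ∸ d) + t)) ≡⟨ bpc ((c ∸ d) + t) ([m∸n]+o<m d≤c t<d) ⟩
    y (suc ((c ∸ d) + t))           ≡⟨ bcd t t<d ⟩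
    y (suc t)                       ∎
    where open ≡-Reasoning

  border-of-border : ∀ {p c l} → Border p c → Border p l → l ≤ c → c ≤ p → Border c l
  border-of-border {p} {c} {l} bpc bpl l≤c c≤p t t<l = begin
    y (suc ((c ∸ l) + t))           ≡⟨ bpc ((c ∸ l) + t) ([m∸n]+o<m l≤c t<l) ⟨
    y (suc (p ∸ c) + ((c ∸ l) + t)) ≡⟨ cong (λ s → y (suc s)) (+-assoc (p ∸ c) (c ∸ l) t) ⟨
    y (suc ((p ∸ c) + (c ∸ l)) + t) ≡⟨ cong (λ s → y (suc (s + t))) ([m∸n]+[n∸o]≡m∸o l≤c c≤p) ⟩
    y (suc (p ∸ l) + t)             ≡⟨ bpl t t<l ⟩
    y (suc t)                       ∎
    where open ≡-Reasoning

  border-init : ∀ {p c} → Border (suc p) c → Border p (c ∸ 1)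
  border-init {c = suc c} b t t<c = b t (≤-trans t<c (n≤1+n c))

  leanBorder-trans : ∀ {p c d} → Border p c → c < p → LeanBorder c d → LeanBorder p d
  leanBorder-trans bpc c<p lcd = record
    { proper = <-trans proper c<p
    ; border = border-trans bpc border (<⇒≤ proper) (<⇒≤ c<p)
    ; lean   = lean
    }
    where open LeanBorder lcd

  cover-proper : ∀ {i m} → HasCover y i m → m < i
  cover-proper (w , refl , cv) = IsCover.short cv

  cover-length-pos : ∀ {i m} → 1 ≤ i → HasCover y i m → 0 < m
  cover-length-pos {m = suc m} _ _ = s≤s z≤n
  cover-length-pos {m = zero} 1≤i (w , |w|≡0 , cv)
    with IsCover.P-covers cv 1 ≤-refl 1≤i
  ... | p , _ , p≤1 , 1<p+|w| =
    contradiction (≤-trans 1<p+|w| (≤-trans (≤-reflexive p+|w|≡p) p≤1)) (<-irrefl refl)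
    where
    p+|w|≡p : p + length w ≡ p
    p+|w|≡p = trans (cong (p +_) |w|≡0) (+-identityʳ p)

  -- The occurrence covering position 1 starts at 1, the one covering position i ends at i.
  cover⇒border : ∀ {i m} → 1 ≤ i → HasCover y i m → Border i m
  cover⇒border {i} 1≤i (w , refl , cv) t t<m
    with IsCover.P-covers cv 1 ≤-refl 1≤i | IsCover.P-covers cv i 1≤i ≤-refl
  ... | p₁ , P₁ , p₁≤1 , _ | p₂ , P₂ , _ , i<p₂+m = begin
    y (suc (i ∸ length w) + t) ≡⟨ cong₂ (λ s u → y (s + u)) p₂≡ toℕ-j ⟨
    y (p₂ + toℕ j)             ≡⟨ P-occ p₂ P₂ j ⟩
    lookup w j                 ≡⟨ P-occ p₁ P₁ j ⟨
    y (p₁ + toℕ j)             ≡⟨ cong₂ (λ s u → y (s + u)) p₁≡1 toℕ-j ⟩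
    y (suc t)                  ∎
    where
    open ≡-Reasoning
    open IsCover cv
    j : Fin (length w)
    j = fromℕ< t<m
    toℕ-j : toℕ j ≡ t
    toℕ-j = toℕ-fromℕ< t<m
    p₁≡1 : p₁ ≡ 1
    p₁≡1 = ≤-antisym p₁≤1 (proj₁ (P-range p₁ P₁))
    p₂+m≡1+i : p₂ + length w ≡ suc i
    p₂+m≡1+i = ≤-antisym (subst (p₂ + length w ≤_) (+-comm i 1) (proj₂ (P-range p₂ P₂))) i<p₂+m
    p₂≡ : p₂ ≡ suc (i ∸ length w)
    p₂≡ = begin
      p₂                     ≡⟨ m+n∸n≡m p₂ (length w) ⟨
      p₂ + length w ∸ length w ≡⟨ cong (_∸ length w) p₂+m≡1+i ⟩
      suc i ∸ length w       ≡⟨ +-∸-assoc 1 (<⇒≤ short) ⟩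
      suc (i ∸ length w)     ∎

  -- A border o of y[1..c] with c ≤ 2o makes y[1..o] a cover, occurring at 1 and at c - o + 1.
  longBorder⇒cover : ∀ {c o} → o < c → c ≤ o + o → Border c o → HasCover y c o
  longBorder⇒cover {c} {o} o<c c≤2o bco =
    w , length-applyUpTo _ o , prefixCover (length-applyUpTo _ o) (lookup-applyUpTo _ o)
    where
    w : List ℕ
    w = applyUpTo (λ t → y (suc t)) o
    q : ℕ
    q = suc (c ∸ o)
    P : ℕ → Bool
    P r = eqb r 1 ∨ eqb r q
    P-cases : ∀ r → P r ≡ true → r ≡ 1 ⊎ r ≡ q
    P-cases r = cases (proof (r ≟ 1)) (proof (r ≟ q))
      where
      cases : ∀ {b₁ b₂} → Reflects (r ≡ 1) b₁ → Reflects (r ≡ q) b₂ →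
              b₁ ∨ b₂ ≡ true → r ≡ 1 ⊎ r ≡ q
      cases (ofʸ r≡1) _         _ = inj₁ r≡1
      cases (ofⁿ _)   (ofʸ r≡q) _ = inj₂ r≡q
      cases (ofⁿ _)   (ofⁿ _)   ()
    P-q : P q ≡ true
    P-q = trans (cong (eqb q 1 ∨_) (dec-true (q ≟ q) refl)) (∨-zeroʳ (eqb q 1))
    q+o≡1+c : q + o ≡ suc c
    q+o≡1+c = cong suc (m∸n+n≡m (<⇒≤ o<c))
    prefixCover : ∀ {v} → length v ≡ o → (∀ j → lookup v j ≡ y (suc (toℕ j))) → IsCover y c v
    prefixCover {v} refl lookup-v = record
      { short    = o<c
      ; P        = P
      ; P-range  = range
      ; P-occ    = occ
      ; P-covers = covers
      }
      where
      range : ∀ r → P r ≡ true → (1 ≤ r) × (r + o ≤ c + 1)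
      range r Pr with P-cases r Pr
      ... | inj₁ refl = ≤-refl , ≤-trans o<c (m≤m+n c 1)
      ... | inj₂ refl = s≤s z≤n , ≤-reflexive (trans q+o≡1+c (+-comm 1 c))
      occ : ∀ r → P r ≡ true → (j : Fin o) → y (r + toℕ j) ≡ lookup v j
      occ r Pr j with P-cases r Pr
      ... | inj₁ refl = sym (lookup-v j)
      ... | inj₂ refl = trans (bco (toℕ j) (toℕ<n j)) (sym (lookup-v j))
      covers : ∀ s → 1 ≤ s → s ≤ c → ∃ λ r → (P r ≡ true) × (r ≤ s) × (s < r + o)
      covers s 1≤s s≤c with s ≤? o
      ... | yes s≤o = 1 , refl , 1≤s , s≤s s≤o
      ... | no s≰o = q , P-q , ≤-trans (s≤s c∸o≤o) (≰⇒> s≰o) , subst (s <_) (sym q+o≡1+c) (s≤s s≤c)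
        where
        c∸o≤o : c ∸ o ≤ o
        c∸o≤o = ≤-trans (∸-monoˡ-≤ o c≤2o) (≤-reflexive (m+n∸n≡m o o))

  noCover⇒noLongBorder : ∀ {c} → (∀ m → ¬ HasCover y c m) → NoLongBorder c
  noCover⇒noLongBorder noCover o o<c c≤2o bco = noCover o (longBorder⇒cover o<c c≤2o bco)

BorderEntry : Str → ℕ → ℕ → Set
BorderEntry y p c = (c ≡ 0 × NoLongBorder y p) ⊎ (0 < c × c < p × Border y p c)

LeanEntry : Str → ℕ → ℕ → Set
LeanEntry y p c = (c ≡ 0 × NoLongBorder y p) ⊎ (0 < c × LeanBorder y p c)

coverArray⇒borderEntry : ∀ {X : Set} y {p c} → 1 ≤ p →
  (c ≡ 0 × (∀ m → ¬ HasCover y p m)) ⊎ (HasCover y p c × X) → BorderEntry y p c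
coverArray⇒borderEntry y _   (inj₁ (c≡0 , noCover)) = inj₁ (c≡0 , noCover⇒noLongBorder y noCover)
coverArray⇒borderEntry y 1≤p (inj₂ (cover , _)) =
  inj₂ (cover-length-pos y 1≤p cover , cover-proper y cover , cover⇒border y 1≤p cover)

validCoverArray⇒borderEntries : ∀ {n C} → ValidCoverArray n C →
  ∃ λ y → ∀ p → 1 ≤ p → p ≤ n → BorderEntry y p (C p)
validCoverArray⇒borderEntries (y , inj₁ minimal) =
  y , λ p 1≤p p≤n → coverArray⇒borderEntry y 1≤p (minimal p 1≤p p≤n)
validCoverArray⇒borderEntries (y , inj₂ maximal) =
  y , λ p 1≤p p≤n → coverArray⇒borderEntry y 1≤p (maximal p 1≤p p≤n)

shorten : Arr → ℕ → ℕ
shorten D c = if eqb c 0 then c else (if eqb (D c) 0 then c else D c)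

maxToMin-above : ∀ i C j → i < j → maxToMin i C j ≡ C j
maxToMin-suc-≢ : ∀ i C j → j ≢ suc i → maxToMin (suc i) C j ≡ maxToMin i C j

maxToMin-above zero    C j _   = refl
maxToMin-above (suc i) C j i<j =
  trans (maxToMin-suc-≢ i C j (>⇒≢ i<j)) (maxToMin-above i C j (<-trans (n<1+n i) i<j))

maxToMin-suc-≢ i C j j≢ = unchanged (eqb c 0) (eqb (D c) 0)
  where
  D = maxToMin i C
  c = D (suc i)
  unchanged : ∀ b₁ b₂ → (if b₁ then D else (if b₂ then D else update D (suc i) (D c))) j ≡ D j
  unchanged true  _     = refl
  unchanged false true  = refl
  unchanged false false = update-≢ D (suc i) (D c) j j≢

maxToMin-suc-≡ : ∀ i C → maxToMin (suc i) C (suc i) ≡ shorten (maxToMin i C) (C (suc i))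
maxToMin-suc-≡ i C = begin
  maxToMin (suc i) C (suc i)  ≡⟨ rule (eqb c 0) (eqb (D c) 0) ⟩
  shorten D c                 ≡⟨ cong (shorten D) (maxToMin-above i C (suc i) (n<1+n i)) ⟩
  shorten D (C (suc i))       ∎
  where
  open ≡-Reasoning
  D = maxToMin i C
  c = D (suc i)
  rule : ∀ b₁ b₂ → (if b₁ then D else (if b₂ then D else update D (suc i) (D c))) (suc i)
                 ≡ (if b₁ then c else (if b₂ then c else D c))
  rule true  _     = refl
  rule false true  = refl
  rule false false = update-≡ D (suc i) (D c)

shorten-lean : ∀ {y p c} D → BorderEntry y p c → (0 < c → c < p → LeanEntry y c (D c)) →
  LeanEntry y p (shorten D c)
shorten-lean D (inj₁ (refl , noLong)) _ = inj₁ (refl , noLong)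
shorten-lean {y} {p} {c} D (inj₂ (0<c , c<p , border)) earlier =
  cases (proof (c ≟ 0)) (proof (D c ≟ 0)) (earlier 0<c c<p)
  where
  cases : ∀ {b₁ b₂} → Reflects (c ≡ 0) b₁ → Reflects (D c ≡ 0) b₂ → LeanEntry y c (D c) →
          LeanEntry y p (if b₁ then c else (if b₂ then c else D c))
  cases (ofʸ c≡0) _         _                       = contradiction c≡0 (n>0⇒n≢0 0<c)
  cases (ofⁿ _)   (ofʸ _)   (inj₁ (_ , noLong))     =
    inj₂ (0<c , record { proper = c<p ; border = border ; lean = noLong })
  cases (ofⁿ _)   (ofʸ d≡0) (inj₂ (0<d , _))        = contradiction d≡0 (n>0⇒n≢0 0<d)
  cases (ofⁿ _)   (ofⁿ d≢0) (inj₁ (d≡0 , _))        = contradiction d≡0 d≢0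
  cases (ofⁿ _)   (ofⁿ _)   (inj₂ (0<d , leanBorder)) = inj₂ (0<d , leanBorder-trans y border c<p leanBorder)

maxToMin-lean : ∀ {y n C} → (∀ p → 1 ≤ p → p ≤ n → BorderEntry y p (C p)) →
  ∀ i → i ≤ n → ∀ p → 1 ≤ p → p ≤ i → LeanEntry y p (maxToMin i C p)
maxToMin-lean entries zero _ p 1≤p p≤0 = contradiction (≤-trans 1≤p p≤0) λ ()
maxToMin-lean {y} {n} {C} entries (suc i) i<n p 1≤p p≤1+i with p ≟ suc i
... | yes refl = subst (LeanEntry y (suc i)) (sym (maxToMin-suc-≡ i C))
      (shorten-lean (maxToMin i C) (entries (suc i) 1≤p i<n)
        (λ 0<c c<1+i → maxToMin-lean entries i (<⇒≤ i<n) _ 0<c (≤-pred c<1+i)))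
... | no p≢1+i = subst (LeanEntry y p) (sym (maxToMin-suc-≢ i C p p≢1+i))
      (maxToMin-lean entries i (<⇒≤ i<n) p 1≤p (≤-pred (≤∧≢⇒< p≤1+i p≢1+i)))

sumUpTo : ℕ → Arr → ℕ
sumUpTo zero    A = 0
sumUpTo (suc i) A = sumUpTo i A + A (suc i)

keep : ℕ → ℕ → ℕ
keep c l = if leb c l then 0 else c

keep-cases : ∀ c l → (keep c l ≡ 0 × c ≤ l) ⊎ (keep c l ≡ c × l < c)
keep-cases c l = cases (proof (c ≤? l))
  where
  cases : ∀ {b} → Reflects (c ≤ l) b →
          ((if b then 0 else c) ≡ 0 × c ≤ l) ⊎ ((if b then 0 else c) ≡ c × l < c)
  cases (ofʸ c≤l) = inj₁ (refl , c≤l)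
  cases (ofⁿ c≰l) = inj₂ (refl , ≰⇒> c≰l)

pruneLoop-above : ∀ i l C j → i < j → pruneLoop i l C j ≡ C j
pruneLoop-above zero    l C j _   = refl
pruneLoop-above (suc i) l C j i<j =
  trans (pruneLoop-above i _ _ j (<-trans (n<1+n i) i<j)) (update-≢ C (suc i) _ j (>⇒≢ i<j))

sumUpTo-pruneLoop-suc : ∀ i l C → let k = keep (C (suc i)) l in
  sumUpTo (suc i) (pruneLoop (suc i) l C)
    ≡ sumUpTo i (pruneLoop i ((l ⊔ k) ∸ 1) (update C (suc i) k)) + k
sumUpTo-pruneLoop-suc i l C =
  cong (sumUpTo i C′ +_)
    (trans (pruneLoop-above i l′ (update C (suc i) k) (suc i) (n<1+n i)) (update-≡ C (suc i) k))
  where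
  k  = keep (C (suc i)) l
  l′ = (l ⊔ k) ∸ 1
  C′ = pruneLoop i l′ (update C (suc i) k)

2*[m∸n]+n≤2*[m∸o] : ∀ {m n o} → o + o ≤ n → n ≤ m → 2 * (m ∸ n) + n ≤ 2 * (m ∸ o)
2*[m∸n]+n≤2*[m∸o] {m} {n} {o} 2o≤n n≤m = begin
  2 * (m ∸ n) + n               ≤⟨ +-monoʳ-≤ (2 * (m ∸ n)) n≤2[n∸o] ⟩
  2 * (m ∸ n) + 2 * (n ∸ o)     ≡⟨ *-distribˡ-+ 2 (m ∸ n) (n ∸ o) ⟨
  2 * ((m ∸ n) + (n ∸ o))       ≡⟨ cong (2 *_) ([m∸n]+[n∸o]≡m∸o o≤n n≤m) ⟩
  2 * (m ∸ o)                   ∎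
  where
  open ≤-Reasoning
  o≤n : o ≤ n
  o≤n = m+n≤o⇒m≤o o 2o≤n
  n≤2[n∸o] : n ≤ 2 * (n ∸ o)
  n≤2[n∸o] = begin
    n                   ≡⟨ m+[n∸m]≡n o≤n ⟨
    o + (n ∸ o)         ≤⟨ +-monoˡ-≤ (n ∸ o) (m+n≤o⇒m≤o∸n o 2o≤n) ⟩
    (n ∸ o) + (n ∸ o)   ≡⟨ cong ((n ∸ o) +_) (+-identityʳ (n ∸ o)) ⟨
    2 * (n ∸ o)         ∎

m∸[n∸1]≡1+m∸n : ∀ m {n} → 0 < n → m ∸ (n ∸ 1) ≡ suc m ∸ n
m∸[n∸1]≡1+m∸n m (s≤s z≤n) = refl

module _ (y : Str) where

  entries-below : ∀ {C} i k → (∀ p → 1 ≤ p → p ≤ suc i → LeanEntry y p (C p)) →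
    ∀ p → 1 ≤ p → p ≤ i → LeanEntry y p (update C (suc i) k p)
  entries-below {C} i k entries p 1≤p p≤i =
    subst (LeanEntry y p) (sym (update-≢ C (suc i) k p (<⇒≢ (s≤s p≤i))))
      (entries p 1≤p (≤-trans p≤i (n≤1+n i)))

  prune-bound : ∀ i l C → (∀ p → 1 ≤ p → p ≤ i → LeanEntry y p (C p)) → l ≤ i → Border y i l →
    sumUpTo i (pruneLoop i l C) ≤ 2 * (i ∸ l)
  prune-step : ∀ i l C k → (∀ p → 1 ≤ p → p ≤ suc i → LeanEntry y p (C p)) → l ≤ suc i →
    Border y (suc i) l → (k ≡ 0 × C (suc i) ≤ l) ⊎ (k ≡ C (suc i) × l < C (suc i)) →
    sumUpTo i (pruneLoop i ((l ⊔ k) ∸ 1) (update C (suc i) k)) + k ≤ 2 * (suc i ∸ l)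

  prune-bound zero    l C _ _ _ = z≤n
  prune-bound (suc i) l C entries l≤ l-border =
    subst (_≤ 2 * (suc i ∸ l)) (sym (sumUpTo-pruneLoop-suc i l C))
      (prune-step i l C _ entries l≤ l-border (keep-cases (C (suc i)) l))

  prune-step i l C _ entries l≤ l-border (inj₁ (refl , _))
    rewrite ⊔-identityʳ l | +-identityʳ (sumUpTo i (pruneLoop i (l ∸ 1) (update C (suc i) 0))) =
    dropped l l≤ l-border
    where
    dropped : ∀ l → l ≤ suc i → Border y (suc i) l →
              sumUpTo i (pruneLoop i (l ∸ 1) (update C (suc i) 0)) ≤ 2 * (suc i ∸ l)
    dropped zero    _         _ = ≤-trans (prune-bound i 0 _ (entries-below i 0 entries) z≤n (λ _ ()))
                                          (*-monoʳ-≤ 2 (n≤1+n i))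
    dropped (suc m) (s≤s m≤i) b = prune-bound i m _ (entries-below i 0 entries) m≤i (border-init y b)
  prune-step i l C _ entries l≤ l-border (inj₂ (refl , l<c)) rewrite m≤n⇒m⊔n≡n (<⇒≤ l<c) =
    kept (entries (suc i) (s≤s z≤n) ≤-refl)
    where
    c = C (suc i)
    kept : LeanEntry y (suc i) c → sumUpTo i (pruneLoop i (c ∸ 1) (update C (suc i) c)) + c ≤ 2 * (suc i ∸ l)
    kept (inj₁ (c≡0 , _)) = contradiction c≡0 (m<n⇒n≢0 l<c)
    kept (inj₂ (0<c , leanBorder)) = begin
      sumUpTo i (pruneLoop i (c ∸ 1) (update C (suc i) c)) + c
        ≤⟨ +-monoˡ-≤ c (prune-bound i (c ∸ 1) _ (entries-below i c entries) c∸1≤i (border-init y border)) ⟩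
      2 * (i ∸ (c ∸ 1)) + c ≡⟨ cong (λ m → 2 * m + c) (m∸[n∸1]≡1+m∸n i 0<c) ⟩
      2 * (suc i ∸ c) + c   ≤⟨ 2*[m∸n]+n≤2*[m∸o] {o = l} 2l≤c (<⇒≤ proper) ⟩
      2 * (suc i ∸ l)       ∎
      where
      open ≤-Reasoning
      open LeanBorder leanBorder
      c∸1≤i : c ∸ 1 ≤ i
      c∸1≤i = ∸-monoˡ-≤ 1 (<⇒≤ proper)
      2l≤c : l + l ≤ c
      2l≤c with l + l ≤? c
      ... | yes 2l≤c = 2l≤c
      ... | no 2l≰c = contradiction (border-of-border y border l-border (<⇒≤ l<c) (<⇒≤ proper))
                                    (lean l l<c (<⇒≤ (≰⇒> 2l≰c)))

pruned-sum-bound : ∀ {n C} → ValidCoverArray n C → sumUpTo n (pruned n C) ≤ 2 * n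
pruned-sum-bound {n} {C} valid with validCoverArray⇒borderEntries valid
... | y , entries = prune-bound y n 0 (maxToMin n C) (maxToMin-lean entries n ≤-refl) z≤n (λ _ ())

length-edgesAt : ∀ i c j → length (edgesAt i c j) ≡ j
length-edgesAt i c zero    = refl
length-edgesAt i c (suc j) =
  trans (length-++ (edgesAt i c j)) (trans (cong (_+ 1) (length-edgesAt i c j)) (+-comm j 1))

numEdges≡sumUpTo : ∀ n CP → numEdges n CP ≡ sumUpTo n CP
numEdges≡sumUpTo zero    CP = refl
numEdges≡sumUpTo (suc i) CP =
  trans (length-++ (edges i CP))
    (cong₂ _+_ (numEdges≡sumUpTo i CP) (length-edgesAt (suc i) (CP (suc i)) (CP (suc i))))

Shrinking : Arr → ℕ → Set
Shrinking B b = ∀ j → 1 ≤ j → j ≤ b → B j < j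

shrinking-mono : ∀ {B b c} → Shrinking B c → b ≤ c → Shrinking B b
shrinking-mono shrinking b≤c j 1≤j j≤b = shrinking j 1≤j (≤-trans j≤b b≤c)

kmpLoop-bound : ∀ fuel x B i b → Shrinking B b →
  proj₁ (kmpLoop fuel x B i b) + proj₂ (kmpLoop fuel x B i b) ≤ b
kmpLoop-bound zero       x B i b       _ = ≤-reflexive (+-identityʳ b)
kmpLoop-bound (suc fuel) x B i zero    _ = z≤n
kmpLoop-bound (suc fuel) x B i (suc b) shrinking = branch (eqb (x (suc (suc b))) (x i))
  where
  r = kmpLoop fuel x B i (B (suc b))
  B<1+b : B (suc b) < suc b
  B<1+b = shrinking (suc b) (s≤s z≤n) ≤-refl
  r-bound : proj₁ r + proj₂ r ≤ B (suc b)
  r-bound = kmpLoop-bound fuel x B i (B (suc b)) (shrinking-mono shrinking (<⇒≤ B<1+b))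
  branch : ∀ found → let r′ = if found then (suc b , 0) else (proj₁ r , suc (proj₂ r)) in
           proj₁ r′ + proj₂ r′ ≤ suc b
  branch true  = ≤-reflexive (+-identityʳ (suc b))
  branch false = begin
    proj₁ r + suc (proj₂ r) ≡⟨ +-suc (proj₁ r) (proj₂ r) ⟩
    suc (proj₁ r + proj₂ r) ≤⟨ ≤-trans (s≤s r-bound) B<1+b ⟩
    suc b                   ∎
    where open ≤-Reasoning

KmpInvariant : ℕ → Arr → ℕ → Set
KmpInvariant i B k = k + B i ≤ i × Shrinking B i

extend-border-≤ : ∀ found b → (if found then suc b else 0) ≤ suc b
extend-border-≤ true  b = ≤-refl
extend-border-≤ false b = z≤n

kmpInvariant-step : ∀ B k i r₁ r₂ b′ → KmpInvariant (suc i) B k →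
  r₁ + r₂ ≤ B (suc i) → b′ ≤ suc r₁ → KmpInvariant (suc (suc i)) (update B (suc (suc i)) b′) (k + r₂)
kmpInvariant-step B k i r₁ r₂ b′ (k+B≤ , shrinking) r-bound b′≤ = cost , shrinking′
  where
  p = suc (suc i)
  B<1+i : B (suc i) < suc i
  B<1+i = shrinking (suc i) (s≤s z≤n) ≤-refl
  r₁<1+i : r₁ < suc i
  r₁<1+i = <-≤-trans (s≤s (≤-trans (m≤m+n r₁ r₂) r-bound)) B<1+i
  cost : k + r₂ + update B p b′ p ≤ p
  cost rewrite update-≡ B p b′ = begin
    k + r₂ + b′          ≤⟨ +-monoʳ-≤ (k + r₂) b′≤ ⟩
    k + r₂ + suc r₁      ≡⟨ +-suc (k + r₂) r₁ ⟩
    suc (k + r₂ + r₁)    ≡⟨ cong suc (+-assoc k r₂ r₁) ⟩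
    suc (k + (r₂ + r₁))  ≤⟨ s≤s (+-monoʳ-≤ k (≤-trans (≤-reflexive (+-comm r₂ r₁)) r-bound)) ⟩
    suc (k + B (suc i))  ≤⟨ s≤s k+B≤ ⟩
    p                    ∎
    where open ≤-Reasoning
  shrinking′ : Shrinking (update B p b′) p
  shrinking′ j 1≤j j≤p with j ≟ p
  ... | yes refl rewrite update-≡ B p b′ = s≤s (≤-trans b′≤ r₁<1+i)
  ... | no j≢p rewrite update-≢ B p b′ j j≢p = shrinking j 1≤j (≤-pred (≤∧≢⇒< j≤p j≢p))

infLoop-invariant : ∀ lab i → KmpInvariant i (bs (infLoop lab i)) (kmpC (infLoop lab i))
infLoop-invariant lab zero = z≤n , λ j 1≤j j≤0 → contradiction (≤-trans 1≤j j≤0) λ ()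
infLoop-invariant lab (suc zero) = z≤n , shrinking
  where
  shrinking : Shrinking (bs (infLoop lab 1)) 1
  shrinking j 1≤j j≤1 with ≤-antisym j≤1 1≤j
  ... | refl = s≤s z≤n
infLoop-invariant lab (suc (suc i)) with infLoop-invariant lab (suc i)
... | invariant@(_ , shrinking) =
  kmpInvariant-step (bs s) (kmpC s) i (proj₁ r) (proj₂ r) _ invariant
    (kmpLoop-bound p x (bs s) p (bs s (suc i))
      (shrinking-mono shrinking (<⇒≤ (shrinking (suc i) (s≤s z≤n) ≤-refl))))
    (extend-border-≤ _ (proj₁ r))
  where
  s = infLoop lab (suc i)
  p = suc (suc i)
  -- step p runs the failure-function loop on the string already extended at position p
  x = xs (infLoop lab p)
  r = kmpLoop p x (bs s) p (bs s (suc i))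

kmpIterations≤ : ∀ lab n → kmpC (infLoop lab n) ≤ n
kmpIterations≤ lab n = m+n≤o⇒m≤o _ (proj₁ (infLoop-invariant lab n))

simaCost-arithmetic : ∀ n E K → E ≤ 2 * n → K ≤ n →
  n + n + (n + 2 * E) + (n + 2 * E) + (n + K) ≤ 14 * n
simaCost-arithmetic n E K E≤ K≤ = begin
  n + n + (n + 2 * E) + (n + 2 * E) + (n + K)
    ≤⟨ +-mono-≤ (+-mono-≤ (+-monoʳ-≤ (n + n) (+-monoʳ-≤ n 2E≤)) (+-monoʳ-≤ n 2E≤)) (+-monoʳ-≤ n K≤) ⟩
  n + n + (n + 2 * (2 * n)) + (n + 2 * (2 * n)) + (n + n)
    ≡⟨ normalise n ⟩
  14 * n ∎
  where
  open ≤-Reasoning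
  2E≤ : 2 * E ≤ 2 * (2 * n)
  2E≤ = *-monoʳ-≤ 2 E≤
  normalise : ∀ n → n + n + (n + 2 * (2 * n)) + (n + 2 * (2 * n)) + (n + n) ≡ 14 * n
  normalise = solve-∀

theorem3 : ∃ λ (c : ℕ) → ∀ (n : ℕ) (C : Arr) → ValidCoverArray n C → simaCost n C ≤ c * n
theorem3 = 14 , λ n C valid →
  let CP = pruned n C in
  simaCost-arithmetic n (numEdges n CP) (kmpC (infLoop (compMin n CP) n))
    (subst (_≤ 2 * n) (sym (numEdges≡sumUpTo n CP)) (pruned-sum-bound valid))
    (kmpIterations≤ (compMin n CP) n)
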